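{- Let $\Gamma$ be the Dynkin diagram of a finite reduced crystallographic root system with simple roots $\alpha_1,\dots,\alpha_r$, $S=\{1,\dots,r\}$, and let $I\subseteq S$. The modified Kostant game on $I$ always terminates (every valid play is finite, and it can be continued until no vertex is sad), and all terminating plays end in the same final configuration $c_I$.
   Context: $\alpha^\vee=2\alpha/(\alpha,\alpha)$, $\langle x,\alpha^\vee\rangle=2(x,\alpha)/(\alpha,\alpha)$. Modified Kostant game on $I$: configurations are integer vectors $c=(c_1,\dots,c_r)$, initially $c=0$; for $u\neq v$, $n_{v,u}=-\langle\alpha_u,\alpha_v^\vee\rangle$. Vertex $v$ is sad in $c$ if $c_v<\frac12(\sum_{u\neq v}n_{v,u}c_u+[v\in I])$ ($[v\in I]$ equals $1$ if $v\in I$ and $0$ otherwise); a move at a sad vertex $v$ replaces $c_v$ by $-c_v+\sum_{u\neq v}n_{v,u}c_u+[v\in I]$, other coordinates unchanged. Moves may only be made at sad vertices; the game terminates when no vertex is sad. -}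

module Defs where

open import Data.Nat using (ℕ)
open import Data.Integer using (ℤ; +_; -_; _+_; _*_; _<_; 0ℤ)
open import Data.Fin using (Fin; zero; suc; _≟_)
open import Data.Fin.Subset using (Subset; _∈_)
open import Data.Fin.Subset.Properties using (_∈?_)
open import Data.List using (List; []; _∷_; _++_)
open import Data.Product using (Σ; _×_; ∃)
open import Data.Unit using (⊤)
open import Relation.Nullary using (¬_; yes; no)
open import Relation.Binary.PropositionalEquality using (_≡_)

Σ[_]_ : (n : ℕ) → (Fin n → ℤ) → ℤ
Σ[ ℕ.zero ] f = 0ℤ
Σ[ ℕ.suc n ] f = f zero + Σ[ n ] (λ i → f (suc i))

-- Data of the Dynkin diagram of a finite reduced crystallographic root
-- system with simple roots α_1,…,α_r: the Gram matrix
-- gram u v = (α_u , α_v) of the simple roots (a basis of the Euclidean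
-- space), rescaled to be integral, together with the Cartan integers
-- n v u = - ⟨α_u , α_v^∨⟩ = - 2 (α_u , α_v) / (α_v , α_v)  (u ≠ v),
-- which are nonnegative integers.
record Dynkin (r : ℕ) : Set where
  field
    gram      : Fin r → Fin r → ℤ
    gram-sym  : ∀ u v → gram u v ≡ gram v u
    gram-pos  : ∀ (x : Fin r → ℤ) → ¬ (∀ i → x i ≡ 0ℤ) →
                0ℤ < Σ[ r ] (λ i → Σ[ r ] (λ j → x i * (gram i j * x j)))
    n         : Fin r → Fin r → ℕ
    n-cartan  : ∀ u v → ¬ (u ≡ v) →
                (+ 2) * gram u v ≡ - ((+ n v u) * gram v v)

module Game {r : ℕ} (Γ : Dynkin r) (I : Subset r) where
  open Dynkin Γ

  Config : Set
  Config = Fin r → ℤ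

  initial : Config
  initial _ = 0ℤ

  ind : Fin r → ℤ
  ind v with v ∈? I
  ... | yes _ = + 1
  ... | no _  = 0ℤ

  rhs : Config → Fin r → ℤ
  rhs c v = Σ[ r ] (λ u → term u) + ind v
    where
      term : Fin r → ℤ
      term u with u ≟ v
      ... | yes _ = 0ℤ
      ... | no _  = (+ n v u) * c u

  -- v is sad in c  iff  c_v < ½ (rhs c v)  iff  2 c_v < rhs c v
  Sad : Config → Fin r → Set
  Sad c v = (+ 2) * c v < rhs c v

  move : Config → Fin r → Config
  move c v w with w ≟ v
  ... | yes _ = - c v + rhs c v
  ... | no _  = c w

  play : Config → List (Fin r) → Config
  play c []       = c
  play c (v ∷ vs) = play (move c v) vs

  Valid : Config → List (Fin r) → Set
  Valid c []       = ⊤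
  Valid c (v ∷ vs) = Sad c v × Valid (move c v) vs

  Terminal : Config → Set
  Terminal c = ∀ v → ¬ Sad c v

  InfinitePlay : Config → Set
  InfinitePlay c = Σ (ℕ → Fin r) λ f →
    ∀ k → Sad (play c (prefix f k)) (f k)
    where
      prefix : (ℕ → Fin r) → ℕ → List (Fin r)
      prefix f ℕ.zero    = []
      prefix f (ℕ.suc k) = prefix f k ++ (f k ∷ [])

{-# OPTIONS --safe #-}
-- Write x = Σ c_u α_u for a configuration c. The deficit D_v = rhs − 2 c_v of a vertex equals
-- [v ∈ I] − ⟨x, α_v^∨⟩, and a move adds D_v to c_v; by the Cartan relations this raises (x, x) by
-- exactly [v ∈ I] (α_v, α_v) D_v. Hence every reachable configuration satisfies c ≥ 0 and
-- (x, x) = Σ_{u ∈ I} (α_u, α_u) c_u. Positive definiteness, made quantitative by induction on Schur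
-- complements, then bounds Σ_u c_u by a constant N, while every move raises Σ_u c_u by at least 1;
-- so every play has at most N moves.
-- Two sad vertices v ≠ w span a rank-two diagram of type A₁×A₁, A₂, B₂ or G₂, and the two alternating
-- plays whose length is its Coxeter number, one starting at v and one at w, are valid and end in the
-- same configuration: a finite computation with linear forms in the deficits of v and w. Termination
-- and this local confluence give a unique final configuration (Newman's lemma).
module Submission where

open import Defs
open import Data.Nat using (ℕ)
open import Data.Fin.Subset using (Subset)
open import Data.List using (List; _++_)
open import Data.Product using (Σ; _×_; ∃)
open import Relation.Nullary using (¬_)
open import Relation.Binary.PropositionalEquality using (_≡_)

open import Data.Bool using (Bool; true; false; not; _∧_; T)
open import Data.Bool.Properties using (T-∧)
open import Function.Bundles using (Equivalence)
open import Data.Empty using (⊥-elim)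
open import Data.Fin using (Fin; zero; suc; _≟_)
open import Data.Fin.Properties using (any?; all?; suc-injective)
open import Data.Integer using (ℤ; +_; -_; _+_; _*_; _-_; _≤_; _<_; 0ℤ; 1ℤ; ∣_∣; +≤+; +<+; -≤+; -[1+_])
open import Data.Integer.Base using (nonNegative; positive)
import Data.Integer.Properties as ℤ
open import Data.Integer.Tactic.RingSolver using (solve-∀)
open import Data.List using ([]; _∷_; map)
import Data.Nat as ℕ
import Data.Nat.Properties as ℕ
open import Data.Product using (_,_; proj₁; proj₂)
open import Data.Sum using (_⊎_; inj₁; inj₂)
open import Data.Unit using (tt)
open import Data.Vec.Functional using (head; tail)
open import Function using (_∘_)
open import Relation.Nullary using (Dec; yes; no; does)
open import Relation.Binary.PropositionalEquality
  using (_≢_; _≗_; refl; sym; trans; cong; cong₂; cong-app; subst; subst₂; module ≡-Reasoning)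

i<j⇒0<j-i : ∀ {i j} → i < j → 0ℤ < j - i
i<j⇒0<j-i {i} {j} i<j = subst (_< j - i) (ℤ.+-inverseʳ i) (ℤ.+-monoˡ-< (- i) i<j)

0<j-i⇒i<j : ∀ {i j} → 0ℤ < j - i → i < j
0<j-i⇒i<j {i} {j} 0<j-i = subst₂ _<_ (ℤ.+-identityˡ i) (j-i+i≡j j i) (ℤ.+-monoˡ-< i 0<j-i)
  where
    j-i+i≡j : ∀ j i → j - i + i ≡ j
    j-i+i≡j = solve-∀

i≤+∣i∣ : ∀ i → i ≤ + ∣ i ∣
i≤+∣i∣ (+ n) = ℤ.≤-refl
i≤+∣i∣ -[1+ n ] = -≤+

*-monoˡ-≤-nonNeg′ : ∀ {k i j} → 0ℤ ≤ k → i ≤ j → k * i ≤ k * j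
*-monoˡ-≤-nonNeg′ {k} 0≤k = ℤ.*-monoˡ-≤-nonNeg k {{nonNegative 0≤k}}

*-nonNeg : ∀ {i j} → 0ℤ ≤ i → 0ℤ ≤ j → 0ℤ ≤ i * j
*-nonNeg {i} 0≤i 0≤j = subst (_≤ i * _) (ℤ.*-zeroʳ i) (*-monoˡ-≤-nonNeg′ 0≤i 0≤j)

*-pos : ∀ {i j} → 0ℤ < i → 0ℤ < j → 0ℤ < i * j
*-pos {i} 0<i 0<j = subst (_< i * _) (ℤ.*-zeroʳ i) (ℤ.*-monoˡ-<-pos i {{positive 0<i}} 0<j)

*-pos-cancelˡ : ∀ {k i} → 0ℤ < k → 0ℤ < k * i → 0ℤ < i
*-pos-cancelˡ {k} {i} 0<k 0<ki =
  ℤ.*-cancelˡ-<-nonNeg k {{nonNegative (ℤ.<⇒≤ 0<k)}} (subst (_< k * i) (sym (ℤ.*-zeroʳ k)) 0<ki)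

square-nonNeg : ∀ i → 0ℤ ≤ i * i
square-nonNeg (+ n) = *-nonNeg {+ n} {+ n} (+≤+ ℕ.z≤n) (+≤+ ℕ.z≤n)
square-nonNeg -[1+ n ] = +≤+ ℕ.z≤n

+-increasing : ∀ {i j} → 0ℤ ≤ j → i ≤ i + j
+-increasing {i} {j} 0≤j = ℤ.i≤i+j i j {{nonNegative 0≤j}}

square-mono-≤ : ∀ {i j} → 0ℤ ≤ i → i ≤ j → i * i ≤ j * j
square-mono-≤ 0≤i i≤j =
  ℤ.≤-trans (*-monoˡ-≤-nonNeg′ 0≤i i≤j) (ℤ.*-monoʳ-≤-nonNeg _ {{nonNegative (ℤ.≤-trans 0≤i i≤j)}} i≤j)

square-+-≤ : ∀ i j → (i + j) * (i + j) ≤ (+ 2) * (i * i + j * j)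
square-+-≤ i j = ℤ.0≤i-j⇒j≤i (subst (0ℤ ≤_) (gap i j) (square-nonNeg (i - j)))
  where
    gap : ∀ i j → (i - j) * (i - j) ≡ (+ 2) * (i * i + j * j) - (i + j) * (i + j)
    gap = solve-∀

square-≤-cancel : ∀ {t k} → 0ℤ ≤ t → 0ℤ ≤ k → t * t ≤ k * t → t ≤ k
square-≤-cancel {+ 0} _ 0≤k _ = 0≤k
square-≤-cancel {+ (ℕ.suc n)} {k} _ _ tt≤kt = ℤ.*-cancelʳ-≤-pos _ k (+ ℕ.suc n) tt≤kt

-- Sums over Fin n

Σ-cong : ∀ {n} {f g : Fin n → ℤ} → f ≗ g → Σ[ n ] f ≡ Σ[ n ] g
Σ-cong {ℕ.zero} f≗g = refl
Σ-cong {ℕ.suc n} f≗g = cong₂ _+_ (f≗g zero) (Σ-cong (f≗g ∘ suc))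

Σ-zero : ∀ n → Σ[ n ] (λ _ → 0ℤ) ≡ 0ℤ
Σ-zero ℕ.zero = refl
Σ-zero (ℕ.suc n) = trans (ℤ.+-identityˡ _) (Σ-zero n)

Σ-+ : ∀ {n} (f g : Fin n → ℤ) → Σ[ n ] (λ i → f i + g i) ≡ Σ[ n ] f + Σ[ n ] g
Σ-+ {ℕ.zero} f g = refl
Σ-+ {ℕ.suc n} f g =
  trans (cong (_+_ (f zero + g zero)) (Σ-+ (f ∘ suc) (g ∘ suc)))
        (interchange (f zero) (g zero) (Σ[ n ] (f ∘ suc)) (Σ[ n ] (g ∘ suc)))
  where
    interchange : ∀ a b c d → (a + b) + (c + d) ≡ (a + c) + (b + d)
    interchange = solve-∀

Σ-neg : ∀ {n} (f : Fin n → ℤ) → Σ[ n ] (λ i → - f i) ≡ - Σ[ n ] f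
Σ-neg {ℕ.zero} f = refl
Σ-neg {ℕ.suc n} f =
  trans (cong (_+_ (- f zero)) (Σ-neg (f ∘ suc))) (sym (ℤ.neg-distrib-+ (f zero) (Σ[ n ] (f ∘ suc))))

Σ-- : ∀ {n} (f g : Fin n → ℤ) → Σ[ n ] (λ i → f i - g i) ≡ Σ[ n ] f - Σ[ n ] g
Σ-- {n} f g = trans (Σ-+ f (λ i → - g i)) (cong (_+_ (Σ[ n ] f)) (Σ-neg g))

*-distribˡ-Σ : ∀ {n} k (f : Fin n → ℤ) → Σ[ n ] (λ i → k * f i) ≡ k * Σ[ n ] f
*-distribˡ-Σ {ℕ.zero} k f = sym (ℤ.*-zeroʳ k)
*-distribˡ-Σ {ℕ.suc n} k f =
  trans (cong (_+_ (k * f zero)) (*-distribˡ-Σ k (f ∘ suc))) (sym (ℤ.*-distribˡ-+ k _ _))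

*-distribʳ-Σ : ∀ {n} k (f : Fin n → ℤ) → Σ[ n ] (λ i → f i * k) ≡ Σ[ n ] f * k
*-distribʳ-Σ k f =
  trans (Σ-cong (λ i → ℤ.*-comm (f i) k)) (trans (*-distribˡ-Σ k f) (ℤ.*-comm k _))

Σ-supported : ∀ {n} (f : Fin n → ℤ) v → (∀ u → u ≢ v → f u ≡ 0ℤ) → Σ[ n ] f ≡ f v
Σ-supported {ℕ.suc n} f zero off =
  trans (cong (_+_ (f zero)) (trans (Σ-cong (λ i → off (suc i) λ ())) (Σ-zero n))) (ℤ.+-identityʳ _)
Σ-supported {ℕ.suc n} f (suc v) off =
  trans (cong (_+ Σ[ n ] (f ∘ suc)) (off zero λ ())) (trans (ℤ.+-identityˡ _)
        (Σ-supported (f ∘ suc) v (λ u u≢v → off (suc u) (u≢v ∘ suc-injective))))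

Σ-mono-≤ : ∀ {n} {f g : Fin n → ℤ} → (∀ i → f i ≤ g i) → Σ[ n ] f ≤ Σ[ n ] g
Σ-mono-≤ {ℕ.zero} f≤g = ℤ.≤-refl
Σ-mono-≤ {ℕ.suc n} f≤g = ℤ.+-mono-≤ (f≤g zero) (Σ-mono-≤ (f≤g ∘ suc))

Σ-nonNeg : ∀ {n} {f : Fin n → ℤ} → (∀ i → 0ℤ ≤ f i) → 0ℤ ≤ Σ[ n ] f
Σ-nonNeg {n} {f} 0≤f = subst (_≤ Σ[ n ] f) (Σ-zero n) (Σ-mono-≤ 0≤f)

upper-bound : ∀ {n} (f : Fin n → ℤ) → ∃ λ B → ∀ i → f i ≤ + B
upper-bound {ℕ.zero} f = 0 , λ ()
upper-bound {ℕ.suc n} f with upper-bound (f ∘ suc)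
... | B , f∘suc≤B = ∣ f zero ∣ ℕ.⊔ B , bounded
  where
    bounded : ∀ i → f i ≤ + (∣ f zero ∣ ℕ.⊔ B)
    bounded zero = ℤ.≤-trans (i≤+∣i∣ (f zero)) (+≤+ (ℕ.m≤m⊔n _ B))
    bounded (suc i) = ℤ.≤-trans (f∘suc≤B i) (+≤+ (ℕ.m≤n⊔m _ B))

point : ∀ {n} → Fin n → ℤ → Fin n → ℤ
point v a u with u ≟ v
... | yes _ = a
... | no _ = 0ℤ

point-at : ∀ {n} (v : Fin n) a → point v a v ≡ a
point-at v a with v ≟ v
... | yes _ = refl
... | no v≢v = ⊥-elim (v≢v refl)

point-off : ∀ {n} {u v : Fin n} a → u ≢ v → point v a u ≡ 0ℤ
point-off {u = u} {v} a u≢v with u ≟ v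
... | yes u≡v = ⊥-elim (u≢v u≡v)
... | no _ = refl

point-+ : ∀ {n} (v : Fin n) a b u → point v a u + point v b u ≡ point v (a + b) u
point-+ v a b u with u ≟ v
... | yes _ = refl
... | no _ = refl

point-zero : ∀ {n} (v : Fin n) u → point v 0ℤ u ≡ 0ℤ
point-zero v u with u ≟ v
... | yes _ = refl
... | no _ = refl

point-nonNeg : ∀ {n} (v : Fin n) {a} → 0ℤ ≤ a → ∀ u → 0ℤ ≤ point v a u
point-nonNeg v 0≤a u with u ≟ v
... | yes _ = 0≤a
... | no _ = ℤ.≤-refl

infixl 6 _+[_]_

_+[_]_ : ∀ {n} → (Fin n → ℤ) → Fin n → ℤ → Fin n → ℤ
(x +[ v ] a) u = x u + point v a u

Σ-+[] : ∀ {n} (x : Fin n → ℤ) v a → Σ[ n ] (x +[ v ] a) ≡ Σ[ n ] x + a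
Σ-+[] x v a =
  trans (Σ-+ x (point v a))
        (cong (_+_ (Σ[ _ ] x)) (trans (Σ-supported (point v a) v (λ _ → point-off a)) (point-at v a)))

Σ-*-+[] : ∀ {n} (f x : Fin n → ℤ) v a →
  Σ[ n ] (λ u → f u * (x +[ v ] a) u) ≡ Σ[ n ] (λ u → f u * x u) + f v * a
Σ-*-+[] f x v a = begin
    Σ[ _ ] (λ u → f u * (x u + point v a u))
  ≡⟨ Σ-cong (λ u → ℤ.*-distribˡ-+ (f u) (x u) (point v a u)) ⟩
    Σ[ _ ] (λ u → f u * x u + f u * point v a u)
  ≡⟨ Σ-+ (λ u → f u * x u) (λ u → f u * point v a u) ⟩
    Σ[ _ ] (λ u → f u * x u) + Σ[ _ ] (λ u → f u * point v a u)
  ≡⟨ cong (_+_ (Σ[ _ ] (λ u → f u * x u))) (Σ-supported (λ u → f u * point v a u) v off) ⟩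
    Σ[ _ ] (λ u → f u * x u) + f v * point v a v
  ≡⟨ cong (λ t → Σ[ _ ] (λ u → f u * x u) + f v * t) (point-at v a) ⟩
    Σ[ _ ] (λ u → f u * x u) + f v * a ∎
  where
    open ≡-Reasoning
    off : ∀ u → u ≢ v → f u * point v a u ≡ 0ℤ
    off u u≢v = trans (cong (f u *_) (point-off a u≢v)) (ℤ.*-zeroʳ (f u))

Σ-+[]-* : ∀ {n} (x : Fin n → ℤ) v a (f : Fin n → ℤ) →
  Σ[ n ] (λ u → (x +[ v ] a) u * f u) ≡ Σ[ n ] (λ u → x u * f u) + a * f v
Σ-+[]-* x v a f =
  trans (Σ-cong (λ u → ℤ.*-comm ((x +[ v ] a) u) (f u)))
        (trans (Σ-*-+[] f x v a)
               (cong₂ _+_ (Σ-cong (λ u → ℤ.*-comm (f u) (x u))) (ℤ.*-comm (f v) a)))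

-- Integral quadratic forms

Matrix : ℕ → Set
Matrix n = Fin n → Fin n → ℤ

Symmetric : ∀ {n} → Matrix n → Set
Symmetric M = ∀ i j → M i j ≡ M j i

QF : ∀ {n} → Matrix n → (Fin n → ℤ) → ℤ
QF {n} M x = Σ[ n ] (λ i → Σ[ n ] (λ j → x i * (M i j * x j)))

PositiveDefinite : ∀ {n} → Matrix n → Set
PositiveDefinite {n} M = ∀ (x : Fin n → ℤ) → ¬ (∀ i → x i ≡ 0ℤ) → 0ℤ < QF M x

image : ∀ {n} → Matrix n → (Fin n → ℤ) → Fin n → ℤ
image {n} M x i = Σ[ n ] (λ j → M i j * x j)

pairing : ∀ {n} → Matrix n → (Fin n → ℤ) → Fin n → ℤ
pairing {n} M x w = Σ[ n ] (λ u → x u * M u w)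

QF-cong : ∀ {n} (M : Matrix n) {x y} → x ≗ y → QF M x ≡ QF M y
QF-cong M x≗y = Σ-cong (λ i → Σ-cong (λ j → cong₂ (λ a b → a * (M i j * b)) (x≗y i) (x≗y j)))

QF-zero : ∀ {n} (M : Matrix n) {x} → (∀ i → x i ≡ 0ℤ) → QF M x ≡ 0ℤ
QF-zero {n} M x≡0 = trans (QF-cong M x≡0) (trans (Σ-cong {n} (λ _ → Σ-zero n)) (Σ-zero n))

QF-nonNeg : ∀ {n} {M : Matrix n} → PositiveDefinite M → ∀ x → 0ℤ ≤ QF M x
QF-nonNeg {M = M} pd x with all? (λ i → x i ℤ.≟ 0ℤ)
... | yes x≡0 = ℤ.≤-reflexive (sym (QF-zero M x≡0))
... | no x≢0 = ℤ.<⇒≤ (pd x x≢0)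

QF-scale : ∀ {n} (M : Matrix n) k y → QF M (λ j → k * y j) ≡ (k * k) * QF M y
QF-scale {n} M k y =
  trans (Σ-cong (λ i → trans (Σ-cong (λ j → pull k (y i) (M i j) (y j)))
                             (*-distribˡ-Σ (k * k) (λ j → y i * (M i j * y j)))))
        (*-distribˡ-Σ (k * k) (λ i → Σ[ n ] (λ j → y i * (M i j * y j))))
  where
    pull : ∀ k a m b → (k * a) * (m * (k * b)) ≡ (k * k) * (a * (m * b))
    pull = solve-∀

QF-image : ∀ {n} (M : Matrix n) x → QF M x ≡ Σ[ n ] (λ i → x i * image M x i)
QF-image M x = Σ-cong (λ i → *-distribˡ-Σ (x i) (λ j → M i j * x j))

QF-+[] : ∀ {n} (M : Matrix n) → Symmetric M → ∀ x w a →
  QF M (x +[ w ] a) ≡ QF M x + (+ 2) * (a * pairing M x w) + a * (M w w * a)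
QF-+[] {n} M M-sym x w a = begin
    QF M y
  ≡⟨ QF-image M y ⟩
    Σ[ n ] (λ i → y i * image M y i)
  ≡⟨ Σ-cong (λ i → trans (cong (y i *_) (Σ-*-+[] (M i) x w a)) (ℤ.*-distribˡ-+ (y i) _ _)) ⟩
    Σ[ n ] (λ i → y i * image M x i + y i * (M i w * a))
  ≡⟨ Σ-+ (λ i → y i * image M x i) (λ i → y i * (M i w * a)) ⟩
    Σ[ n ] (λ i → y i * image M x i) + Σ[ n ] (λ i → y i * (M i w * a))
  ≡⟨ cong₂ _+_ (Σ-+[]-* x w a (image M x)) (Σ-+[]-* x w a (λ i → M i w * a)) ⟩
    (Σ[ n ] (λ i → x i * image M x i) + a * image M x w)
      + (Σ[ n ] (λ i → x i * (M i w * a)) + a * (M w w * a))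
  ≡⟨ cong₂ (λ s t → (s + a * t) + (Σ[ n ] (λ i → x i * (M i w * a)) + a * (M w w * a)))
           (sym (QF-image M x)) image≡pairing ⟩
    (QF M x + a * P) + (Σ[ n ] (λ i → x i * (M i w * a)) + a * (M w w * a))
  ≡⟨ cong (λ t → (QF M x + a * P) + (t + a * (M w w * a))) column≡ ⟩
    (QF M x + a * P) + (P * a + a * (M w w * a))
  ≡⟨ collect (QF M x) a P (a * (M w w * a)) ⟩
    QF M x + (+ 2) * (a * P) + a * (M w w * a) ∎
  where
    open ≡-Reasoning
    y = x +[ w ] a
    P = pairing M x w
    image≡pairing : image M x w ≡ P
    image≡pairing = Σ-cong (λ j → trans (cong (_* x j) (M-sym w j)) (ℤ.*-comm (M j w) (x j)))
    column≡ : Σ[ n ] (λ i → x i * (M i w * a)) ≡ P * a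
    column≡ = trans (Σ-cong (λ i → sym (ℤ.*-assoc (x i) (M i w) a))) (*-distribʳ-Σ a (λ i → x i * M i w))
    collect : ∀ q a p t → (q + a * p) + (p * a + t) ≡ q + (+ 2) * (a * p) + t
    collect = solve-∀

QF-point : ∀ {n} (M : Matrix n) → Symmetric M → ∀ w a → QF M ((λ _ → 0ℤ) +[ w ] a) ≡ a * (M w w * a)
QF-point {n} M M-sym w a =
  trans (QF-+[] M M-sym (λ _ → 0ℤ) w a)
        (trans (cong₂ (λ q p → q + (+ 2) * (a * p) + a * (M w w * a)) (QF-zero M (λ _ → refl)) (Σ-zero n))
               (drop a (M w w)))
  where
    drop : ∀ a m → 0ℤ + (+ 2) * (a * 0ℤ) + a * (m * a) ≡ a * (m * a)
    drop = solve-∀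

PD⇒diagonal-pos : ∀ {n} {M : Matrix n} → Symmetric M → PositiveDefinite M → ∀ i → 0ℤ < M i i
PD⇒diagonal-pos {M = M} M-sym pd i =
  subst (0ℤ <_) (trans (QF-point M M-sym i 1ℤ) (unit (M i i))) (pd _ e≢0)
  where
    unit : ∀ m → 1ℤ * (m * 1ℤ) ≡ m
    unit = solve-∀
    1≢0 : 1ℤ ≢ 0ℤ
    1≢0 ()
    e≢0 : ¬ (∀ j → ((λ _ → 0ℤ) +[ i ] 1ℤ) j ≡ 0ℤ)
    e≢0 e≡0 = 1≢0 (trans (cong (_+_ 0ℤ) (sym (point-at i 1ℤ))) (e≡0 i))

SumBound : ∀ {n} → Matrix n → ℤ → Set
SumBound {n} M K = ∀ z → (∀ i → 0ℤ ≤ z i) → Σ[ n ] z * Σ[ n ] z ≤ K * QF M z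

module Schur {m : ℕ} (M : Matrix (ℕ.suc m)) where

  g : ℤ
  g = M zero zero

  b : Fin m → ℤ
  b j = M zero (suc j)

  M′ : Matrix m
  M′ i j = M (suc i) (suc j)

  dot : (Fin m → ℤ) → ℤ
  dot y = Σ[ m ] (λ j → b j * y j)

  complement : Matrix m
  complement i j = g * M′ i j - b i * b j

  dot-scale : ∀ k y → dot (λ j → k * y j) ≡ k * dot y
  dot-scale k y = trans (Σ-cong (λ j → swap (b j) k (y j))) (*-distribˡ-Σ k (λ j → b j * y j))
    where
      swap : ∀ b k y → b * (k * y) ≡ k * (b * y)
      swap = solve-∀

  QF-split : Symmetric M → ∀ z →
    QF M z ≡ g * (head z * head z) + (+ 2) * (head z * dot (tail z)) + QF M′ (tail z)
  QF-split M-sym z = begin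
      (z₀ * (g * z₀) + Σ[ m ] (λ j → z₀ * (b j * z′ j)))
        + Σ[ m ] (λ i → z′ i * (M (suc i) zero * z₀) + Σ[ m ] (λ j → z′ i * (M′ i j * z′ j)))
    ≡⟨ cong₂ _+_ (cong (_+_ (z₀ * (g * z₀))) (*-distribˡ-Σ z₀ (λ j → b j * z′ j)))
                 (Σ-+ (λ i → z′ i * (M (suc i) zero * z₀)) (λ i → Σ[ m ] (λ j → z′ i * (M′ i j * z′ j)))) ⟩
      (z₀ * (g * z₀) + z₀ * d) + (Σ[ m ] (λ i → z′ i * (M (suc i) zero * z₀)) + QF M′ z′)
    ≡⟨ cong (λ t → (z₀ * (g * z₀) + z₀ * d) + (t + QF M′ z′)) column≡ ⟩
      (z₀ * (g * z₀) + z₀ * d) + (z₀ * d + QF M′ z′)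
    ≡⟨ collect z₀ g d (QF M′ z′) ⟩
      g * (z₀ * z₀) + (+ 2) * (z₀ * d) + QF M′ z′ ∎
    where
      open ≡-Reasoning
      z₀ = head z
      z′ = tail z
      d = dot z′
      rearrange : ∀ x y z → x * (y * z) ≡ z * (y * x)
      rearrange = solve-∀
      collect : ∀ z g d q → (z * (g * z) + z * d) + (z * d + q) ≡ g * (z * z) + (+ 2) * (z * d) + q
      collect = solve-∀
      column≡ : Σ[ m ] (λ i → z′ i * (M (suc i) zero * z₀)) ≡ z₀ * d
      column≡ = trans (Σ-cong (λ i → trans (cong (λ t → z′ i * (t * z₀)) (M-sym (suc i) zero))
                                           (rearrange (z′ i) (b i) z₀)))
                      (*-distribˡ-Σ z₀ (λ j → b j * z′ j))

  QF-complement : ∀ y → QF complement y ≡ g * QF M′ y - dot y * dot y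
  QF-complement y = begin
      Σ[ m ] (λ i → Σ[ m ] (λ j → y i * (complement i j * y j)))
    ≡⟨ Σ-cong row ⟩
      Σ[ m ] (λ i → g * Σ[ m ] (λ j → y i * (M′ i j * y j)) - (y i * b i) * dot y)
    ≡⟨ Σ-- (λ i → g * Σ[ m ] (λ j → y i * (M′ i j * y j))) (λ i → (y i * b i) * dot y) ⟩
      Σ[ m ] (λ i → g * Σ[ m ] (λ j → y i * (M′ i j * y j))) - Σ[ m ] (λ i → (y i * b i) * dot y)
    ≡⟨ cong₂ _-_ (*-distribˡ-Σ g (λ i → Σ[ m ] (λ j → y i * (M′ i j * y j))))
                 (trans (*-distribʳ-Σ (dot y) (λ i → y i * b i))
                        (cong (_* dot y) (Σ-cong (λ i → ℤ.*-comm (y i) (b i))))) ⟩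
      g * QF M′ y - dot y * dot y ∎
    where
      open ≡-Reasoning
      expand : ∀ y g m b b′ y′ → y * ((g * m - b * b′) * y′) ≡ g * (y * (m * y′)) - (y * b) * (b′ * y′)
      expand = solve-∀
      row : ∀ i → Σ[ m ] (λ j → y i * (complement i j * y j))
                ≡ g * Σ[ m ] (λ j → y i * (M′ i j * y j)) - (y i * b i) * dot y
      row i =
        trans (Σ-cong (λ j → expand (y i) g (M′ i j) (b i) (b j) (y j)))
              (trans (Σ-- (λ j → g * (y i * (M′ i j * y j))) (λ j → (y i * b i) * (b j * y j)))
                     (cong₂ _-_ (*-distribˡ-Σ g (λ j → y i * (M′ i j * y j)))
                                (*-distribˡ-Σ (y i * b i) (λ j → b j * y j))))

  complete-square : Symmetric M → ∀ z →
    g * QF M z ≡ (g * head z + dot (tail z)) * (g * head z + dot (tail z)) + QF complement (tail z)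
  complete-square M-sym z =
    trans (cong (g *_) (QF-split M-sym z))
          (trans (square g (head z) (dot (tail z)) (QF M′ (tail z)))
                 (cong (_+_ (X * X)) (sym (QF-complement (tail z)))))
    where
      X = g * head z + dot (tail z)
      square : ∀ g z d q → g * (g * (z * z) + (+ 2) * (z * d) + q) ≡ (g * z + d) * (g * z + d) + (g * q - d * d)
      square = solve-∀

  complement-symmetric : Symmetric M → Symmetric complement
  complement-symmetric M-sym i j = cong₂ _-_ (cong (g *_) (M-sym (suc i) (suc j))) (ℤ.*-comm (b i) (b j))

  complement-positiveDefinite : Symmetric M → PositiveDefinite M → PositiveDefinite complement
  complement-positiveDefinite M-sym pd y y≢0 =
    *-pos-cancelˡ (*-pos 0<g 0<g) (subst (0ℤ <_) gQw≡ (*-pos 0<g (pd w w≢0)))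
    where
      open ≡-Reasoning
      0<g : 0ℤ < g
      0<g = PD⇒diagonal-pos M-sym pd zero
      w : Fin (ℕ.suc m) → ℤ
      w zero = - dot y
      w (suc j) = g * y j
      w≢0 : ¬ (∀ i → w i ≡ 0ℤ)
      w≢0 w≡0 = y≢0 (λ j → cancel (ℤ.i*j≡0⇒i≡0∨j≡0 g (w≡0 (suc j))))
        where
          cancel : ∀ {t} → g ≡ 0ℤ ⊎ t ≡ 0ℤ → t ≡ 0ℤ
          cancel (inj₁ g≡0) = ⊥-elim (ℤ.<-irrefl (sym g≡0) 0<g)
          cancel (inj₂ t≡0) = t≡0
      vanish : ∀ g d q → (g * - d + g * d) * (g * - d + g * d) + q ≡ q
      vanish = solve-∀
      gQw≡ : g * QF M w ≡ (g * g) * QF complement y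
      gQw≡ = begin
          g * QF M w
        ≡⟨ complete-square M-sym w ⟩
          (g * - dot y + dot (tail w)) * (g * - dot y + dot (tail w)) + QF complement (tail w)
        ≡⟨ cong₂ (λ s t → (g * - dot y + s) * (g * - dot y + s) + t) (dot-scale g y) (QF-scale complement g y) ⟩
          (g * - dot y + g * dot y) * (g * - dot y + g * dot y) + (g * g) * QF complement y
        ≡⟨ vanish g (dot y) _ ⟩
          (g * g) * QF complement y ∎

  B : ℕ
  B = proj₁ (upper-bound (λ j → - b j))

  sum-≤ : 0ℤ < g → ∀ z → (∀ i → 0ℤ ≤ z i) →
    Σ[ ℕ.suc m ] z ≤ (g * head z + dot (tail z)) + (+ B + 1ℤ) * Σ[ m ] (tail z)
  sum-≤ 0<g z 0≤z = ℤ.0≤i-j⇒j≤i (subst (0ℤ ≤_) (sym (slack g z₀ (dot z′) (+ B) S′))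
                                    (ℤ.+-mono-≤ (ℤ.i≤j⇒0≤j-i z₀≤gz₀) (ℤ.i≤j⇒0≤j-i -d≤BS′)))
    where
      open ℤ.≤-Reasoning
      z₀ = head z
      z′ = tail z
      S′ = Σ[ m ] z′
      slack : ∀ g z d β s → (g * z + d) + (β + 1ℤ) * s - (z + s) ≡ (g * z - z) + (β * s - - d)
      slack = solve-∀
      z₀≤gz₀ : z₀ ≤ g * z₀
      z₀≤gz₀ = subst (_≤ g * z₀) (ℤ.*-identityˡ z₀)
                     (ℤ.*-monoʳ-≤-nonNeg z₀ {{nonNegative (0≤z zero)}} (ℤ.i<j⇒suc[i]≤j 0<g))
      -d≤BS′ : - dot z′ ≤ + B * S′
      -d≤BS′ = begin
        - dot z′                         ≡⟨ sym (Σ-neg (λ j → b j * z′ j)) ⟩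
        Σ[ m ] (λ j → - (b j * z′ j))    ≡⟨ Σ-cong (λ j → ℤ.neg-distribˡ-* (b j) (z′ j)) ⟩
        Σ[ m ] (λ j → - b j * z′ j)      ≤⟨ Σ-mono-≤ (λ j → ℤ.*-monoʳ-≤-nonNeg (z′ j) {{nonNegative (0≤z (suc j))}}
                                                                          (proj₂ (upper-bound (λ j → - b j)) j)) ⟩
        Σ[ m ] (λ j → + B * z′ j)        ≡⟨ *-distribˡ-Σ (+ B) z′ ⟩
        + B * S′                         ∎

  -- K comes from (Σ z)² ≤ 2X² + 2((B + 1) Σ z′)², where X = g z₀ + dot z′ and g Q(z) = X² + Q″(z′).
  sumBound-step : Symmetric M → PositiveDefinite M →
    (∃ λ K′ → 0ℤ ≤ K′ × SumBound complement K′) → ∃ λ K → 0ℤ ≤ K × SumBound M K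
  sumBound-step M-sym pd (K′ , 0≤K′ , bound′) = K , 0≤K , bound
    where
      B₁ = + B + 1ℤ
      K = (+ 2) * ((1ℤ + B₁ * B₁ * K′) * g)
      0<g : 0ℤ < g
      0<g = PD⇒diagonal-pos M-sym pd zero
      0≤K : 0ℤ ≤ K
      0≤K = *-nonNeg {+ 2} (+≤+ ℕ.z≤n)
              (*-nonNeg (ℤ.+-mono-≤ {0ℤ} {1ℤ} (+≤+ ℕ.z≤n) (*-nonNeg (square-nonNeg B₁) 0≤K′)) (ℤ.<⇒≤ 0<g))
      factor : ∀ g q β k → (+ 2) * (g * q + β * β * k * (g * q)) ≡ (+ 2) * ((1ℤ + β * β * k) * g) * q
      factor = solve-∀
      square-* : ∀ β s → (β * s) * (β * s) ≡ β * β * (s * s)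
      square-* = solve-∀
      bound : SumBound M K
      bound z 0≤z = begin
          S * S                                      ≤⟨ square-mono-≤ (Σ-nonNeg 0≤z) (sum-≤ 0<g z 0≤z) ⟩
          (X + Y) * (X + Y)                          ≤⟨ square-+-≤ X Y ⟩
          (+ 2) * (X * X + Y * Y)                    ≤⟨ *-monoˡ-≤-nonNeg′ {+ 2} (+≤+ ℕ.z≤n) (ℤ.+-mono-≤ X²≤gQ Y²≤) ⟩
          (+ 2) * (g * Q + B₁ * B₁ * K′ * (g * Q))   ≡⟨ factor g Q B₁ K′ ⟩
          K * Q                                      ∎
        where
          open ℤ.≤-Reasoning
          z′ = tail z
          S = Σ[ ℕ.suc m ] z
          S′ = Σ[ m ] z′
          X = g * head z + dot z′
          Y = B₁ * S′
          Q = QF M z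
          Q″ = QF complement z′
          gQ≡ : g * Q ≡ X * X + Q″
          gQ≡ = complete-square M-sym z
          0≤Q″ : 0ℤ ≤ Q″
          0≤Q″ = QF-nonNeg {M = complement} (complement-positiveDefinite M-sym pd) z′
          X²≤gQ : X * X ≤ g * Q
          X²≤gQ = subst (X * X ≤_) (sym gQ≡) (+-increasing 0≤Q″)
          Q″≤gQ : Q″ ≤ g * Q
          Q″≤gQ = subst (Q″ ≤_) (trans (ℤ.+-comm Q″ (X * X)) (sym gQ≡)) (+-increasing (square-nonNeg X))
          Y²≤ : Y * Y ≤ B₁ * B₁ * K′ * (g * Q)
          Y²≤ = begin
            Y * Y                       ≡⟨ square-* B₁ S′ ⟩
            B₁ * B₁ * (S′ * S′)         ≤⟨ *-monoˡ-≤-nonNeg′ (square-nonNeg B₁) (bound′ z′ (0≤z ∘ suc)) ⟩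
            B₁ * B₁ * (K′ * Q″)         ≤⟨ *-monoˡ-≤-nonNeg′ (square-nonNeg B₁) (*-monoˡ-≤-nonNeg′ 0≤K′ Q″≤gQ) ⟩
            B₁ * B₁ * (K′ * (g * Q))    ≡⟨ sym (ℤ.*-assoc (B₁ * B₁) K′ (g * Q)) ⟩
            B₁ * B₁ * K′ * (g * Q)      ∎

sumBound : ∀ n (M : Matrix n) → Symmetric M → PositiveDefinite M → ∃ λ K → 0ℤ ≤ K × SumBound M K
sumBound ℕ.zero M _ _ = 0ℤ , ℤ.≤-refl , λ _ _ → ℤ.≤-refl
sumBound (ℕ.suc m) M M-sym pd =
  sumBound-step M-sym pd (sumBound m complement (complement-symmetric M-sym) (complement-positiveDefinite M-sym pd))
  where open Schur M

-- The Dynkin diagram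

data RankTwo : ℕ → ℕ → Set where
  A₁×A₁ : RankTwo 0 0
  A₂ : RankTwo 1 1
  B₂ : RankTwo 1 2
  B₂ᵀ : RankTwo 2 1
  G₂ : RankTwo 1 3
  G₂ᵀ : RankTwo 3 1

rankTwo-classify : ∀ p q → (p ≡ 0 → q ≡ 0) → (q ≡ 0 → p ≡ 0) → ¬ 4 ℕ.≤ p ℕ.* q → RankTwo p q
rankTwo-classify 0 0 _ _ _ = A₁×A₁
rankTwo-classify 0 (ℕ.suc q) p≡0⇒q≡0 _ _ with p≡0⇒q≡0 refl
... | ()
rankTwo-classify (ℕ.suc p) 0 _ q≡0⇒p≡0 _ with q≡0⇒p≡0 refl
... | ()
rankTwo-classify 1 1 _ _ _ = A₂
rankTwo-classify 1 2 _ _ _ = B₂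
rankTwo-classify 1 3 _ _ _ = G₂
rankTwo-classify 2 1 _ _ _ = B₂ᵀ
rankTwo-classify 3 1 _ _ _ = G₂ᵀ
rankTwo-classify 1 (ℕ.suc (ℕ.suc (ℕ.suc (ℕ.suc q)))) _ _ pq≱4 = ⊥-elim (pq≱4 (ℕ.s≤s (ℕ.s≤s (ℕ.s≤s (ℕ.s≤s ℕ.z≤n)))))
rankTwo-classify (ℕ.suc (ℕ.suc (ℕ.suc (ℕ.suc p)))) 1 _ _ pq≱4 = ⊥-elim (pq≱4 (ℕ.s≤s (ℕ.s≤s (ℕ.s≤s (ℕ.s≤s ℕ.z≤n)))))
rankTwo-classify (ℕ.suc (ℕ.suc p)) (ℕ.suc (ℕ.suc q)) _ _ pq≱4 =
  ⊥-elim (pq≱4 (ℕ.*-mono-≤ {2} {ℕ.suc (ℕ.suc p)} {2} {ℕ.suc (ℕ.suc q)} (ℕ.s≤s (ℕ.s≤s ℕ.z≤n)) (ℕ.s≤s (ℕ.s≤s ℕ.z≤n))))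

module DynkinDiagram {r : ℕ} (Γ : Dynkin r) where
  open Dynkin Γ

  gram-diagonal-pos : ∀ v → 0ℤ < gram v v
  gram-diagonal-pos = PD⇒diagonal-pos gram-sym gram-pos

  adj : Fin r → Fin r → ℤ
  adj v u with u ≟ v
  ... | yes _ = 0ℤ
  ... | no _ = + n v u

  adj-diag : ∀ v → adj v v ≡ 0ℤ
  adj-diag v with v ≟ v
  ... | yes _ = refl
  ... | no v≢v = ⊥-elim (v≢v refl)

  adj-off : ∀ {u v} → u ≢ v → adj v u ≡ + n v u
  adj-off {u} {v} u≢v with u ≟ v
  ... | yes u≡v = ⊥-elim (u≢v u≡v)
  ... | no _ = refl

  neighbourSum : (Fin r → ℤ) → Fin r → ℤ
  neighbourSum c v = Σ[ r ] (λ u → adj v u * c u)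

  private
    cartan-sum : ∀ {u v} → u ≢ v → (+ 2) * gram u v + + n v u * gram v v ≡ 0ℤ
    cartan-sum {u} {v} u≢v =
      trans (cong (_+ + n v u * gram v v) (n-cartan u v u≢v)) (ℤ.+-inverseˡ (+ n v u * gram v v))

  coroot-pairing : ∀ c v → (+ 2) * pairing gram c v ≡ gram v v * ((+ 2) * c v - neighbourSum c v)
  coroot-pairing c v = begin
      (+ 2) * P
    ≡⟨ add-sub ((+ 2) * P) (R * gram v v) ⟩
      ((+ 2) * P + R * gram v v) - R * gram v v
    ≡⟨ cong (_- R * gram v v) (sym (trans (Σ-+ (λ u → (+ 2) * (c u * gram u v)) (λ u → (adj v u * c u) * gram v v))
                                             (cong₂ _+_ (*-distribˡ-Σ (+ 2) (λ u → c u * gram u v))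
                                                        (*-distribʳ-Σ (gram v v) (λ u → adj v u * c u))))) ⟩
      Σ[ r ] f - R * gram v v
    ≡⟨ cong (_- R * gram v v) (Σ-supported f v f-off) ⟩
      (+ 2) * (c v * gram v v) + (adj v v * c v) * gram v v - R * gram v v
    ≡⟨ cong (λ t → (+ 2) * (c v * gram v v) + (t * c v) * gram v v - R * gram v v) (adj-diag v) ⟩
      (+ 2) * (c v * gram v v) + (0ℤ * c v) * gram v v - R * gram v v
    ≡⟨ factor (c v) (gram v v) R ⟩
      gram v v * ((+ 2) * c v - R) ∎
    where
      open ≡-Reasoning
      P = pairing gram c v
      R = neighbourSum c v
      f : Fin r → ℤ
      f u = (+ 2) * (c u * gram u v) + (adj v u * c u) * gram v v
      add-sub : ∀ x y → x ≡ (x + y) - y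
      add-sub = solve-∀
      factor : ∀ x g R → (+ 2) * (x * g) + (0ℤ * x) * g - R * g ≡ g * ((+ 2) * x - R)
      factor = solve-∀
      collect : ∀ x m g h → (+ 2) * (x * h) + (m * x) * g ≡ x * ((+ 2) * h + m * g)
      collect = solve-∀
      f-off : ∀ u → u ≢ v → f u ≡ 0ℤ
      f-off u u≢v = begin
          (+ 2) * (c u * gram u v) + (adj v u * c u) * gram v v
        ≡⟨ cong (λ t → (+ 2) * (c u * gram u v) + (t * c u) * gram v v) (adj-off u≢v) ⟩
          (+ 2) * (c u * gram u v) + (+ n v u * c u) * gram v v
        ≡⟨ collect (c u) (+ n v u) (gram v v) (gram u v) ⟩
          c u * ((+ 2) * gram u v + + n v u * gram v v)
        ≡⟨ cong (c u *_) (cartan-sum u≢v) ⟩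
          c u * 0ℤ
        ≡⟨ ℤ.*-zeroʳ (c u) ⟩
          0ℤ ∎

  n-zero-sym : ∀ {u v} → u ≢ v → n v u ≡ 0 → n u v ≡ 0
  n-zero-sym {u} {v} u≢v nvu≡0 = ℤ.+-injective (nonzero-factor (ℤ.i*j≡0⇒i≡0∨j≡0 (+ n u v) nuv*guu≡0))
    where
      2guv≡0 : (+ 2) * gram u v ≡ 0ℤ
      2guv≡0 = trans (sym (ℤ.+-identityʳ _))
                     (trans (cong (λ k → (+ 2) * gram u v + + k * gram v v) (sym nvu≡0)) (cartan-sum u≢v))
      guv≡0 : gram u v ≡ 0ℤ
      guv≡0 with ℤ.i*j≡0⇒i≡0∨j≡0 (+ 2) 2guv≡0
      ... | inj₂ guv≡0 = guv≡0
      nuv*guu≡0 : + n u v * gram u u ≡ 0ℤ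
      nuv*guu≡0 = trans (sym (ℤ.+-identityˡ _))
                        (trans (cong (λ t → (+ 2) * t + + n u v * gram u u) (sym (trans (gram-sym v u) guv≡0)))
                               (cartan-sum (u≢v ∘ sym)))
      nonzero-factor : + n u v ≡ 0ℤ ⊎ gram u u ≡ 0ℤ → + n u v ≡ 0ℤ
      nonzero-factor (inj₁ nuv≡0) = nuv≡0
      nonzero-factor (inj₂ guu≡0) = ⊥-elim (ℤ.<-irrefl (sym guu≡0) (gram-diagonal-pos u))

  QF-rankTwo : ∀ {u v} → u ≢ v →
    + n v u * QF gram ((λ _ → 0ℤ) +[ u ] + n u v +[ v ] + 2) ≡ (+ n u v * gram u u) * ((+ 4) - + n v u * + n u v)
  QF-rankTwo {u} {v} u≢v = begin
      p * QF gram (x +[ v ] + 2)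
    ≡⟨ cong (p *_) (trans (QF-+[] gram gram-sym x v (+ 2))
                          (cong₂ (λ s t → s + (+ 2) * ((+ 2) * t) + (+ 2) * (b * (+ 2))) (QF-point gram gram-sym u q) pairing≡)) ⟩
      p * (q * (a * q) + (+ 2) * ((+ 2) * (q * h)) + (+ 2) * (b * (+ 2)))
    ≡⟨ combination p q a b h ⟩
      (q * a) * ((+ 4) - p * q) + ((+ 2) * (p * q)) * ((+ 2) * h + q * a)
        + (+ 4) * (((+ 2) * h + p * b) - ((+ 2) * h + q * a))
    ≡⟨ cong₂ (λ s t → (q * a) * ((+ 4) - p * q) + ((+ 2) * (p * q)) * s + (+ 4) * (t - s))
             (trans (cong (λ t → (+ 2) * t + q * a) (gram-sym u v)) (cartan-sum (u≢v ∘ sym)))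
             (cartan-sum u≢v) ⟩
      (q * a) * ((+ 4) - p * q) + ((+ 2) * (p * q)) * 0ℤ + (+ 4) * (0ℤ - 0ℤ)
    ≡⟨ drop-zeros ((q * a) * ((+ 4) - p * q)) ((+ 2) * (p * q)) ⟩
      (q * a) * ((+ 4) - p * q) ∎
    where
      open ≡-Reasoning
      p = + n v u
      q = + n u v
      a = gram u u
      b = gram v v
      h = gram u v
      x = (λ _ → 0ℤ) +[ u ] q
      pairing≡ : pairing gram x v ≡ q * h
      pairing≡ = trans (Σ-+[]-* (λ _ → 0ℤ) u q (λ w → gram w v)) (trans (cong (_+ q * h) (Σ-zero r)) (ℤ.+-identityˡ _))
      combination : ∀ p q a b h → p * (q * (a * q) + (+ 2) * ((+ 2) * (q * h)) + (+ 2) * (b * (+ 2)))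
        ≡ (q * a) * ((+ 4) - p * q) + ((+ 2) * (p * q)) * ((+ 2) * h + q * a)
          + (+ 4) * (((+ 2) * h + p * b) - ((+ 2) * h + q * a))
      combination = solve-∀
      drop-zeros : ∀ t s → t + s * 0ℤ + (+ 4) * (0ℤ - 0ℤ) ≡ t
      drop-zeros = solve-∀

  n-product≱4 : ∀ {u v} → u ≢ v → ¬ 4 ℕ.≤ n v u ℕ.* n u v
  n-product≱4 {u} {v} u≢v 4≤pq =
    ℤ.<-irrefl refl (ℤ.<-≤-trans (subst (0ℤ <_) (QF-rankTwo u≢v) 0<pQ) qa[4-pq]≤0)
    where
      x = (λ _ → 0ℤ) +[ u ] + n u v +[ v ] + 2
      positive-factor : ∀ k {l} → 4 ℕ.≤ k ℕ.* l → 0ℤ < + k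
      positive-factor (ℕ.suc k) _ = +<+ (ℕ.s≤s ℕ.z≤n)
      x≢0 : ¬ (∀ i → x i ≡ 0ℤ)
      x≢0 x≡0 with trans (sym (cong₂ (λ s t → (0ℤ + s) + t) (point-off (+ n u v) (u≢v ∘ sym)) (point-at v (+ 2)))) (x≡0 v)
      ... | ()
      0<pQ : 0ℤ < + n v u * QF gram x
      0<pQ = *-pos (positive-factor (n v u) 4≤pq) (gram-pos x x≢0)
      qa[4-pq]≤0 : (+ n u v * gram u u) * ((+ 4) - + n v u * + n u v) ≤ 0ℤ
      qa[4-pq]≤0 = subst ((+ n u v * gram u u) * ((+ 4) - + n v u * + n u v) ≤_) (ℤ.*-zeroʳ (+ n u v * gram u u))
                     (*-monoˡ-≤-nonNeg′ (*-nonNeg {+ n u v} (+≤+ ℕ.z≤n) (ℤ.<⇒≤ (gram-diagonal-pos u)))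
                                        (ℤ.i≤j⇒i-j≤0 (subst (+ 4 ≤_) (ℤ.pos-* (n v u) (n u v)) (+≤+ 4≤pq))))

  rankTwo : ∀ {u v} → u ≢ v → RankTwo (n v u) (n u v)
  rankTwo u≢v = rankTwo-classify _ _ (n-zero-sym u≢v) (n-zero-sym (u≢v ∘ sym)) (n-product≱4 u≢v)

-- Braid relations in rank two

LinForm : Set
LinForm = ℤ × ℤ

infixl 6 _⊕_
infixl 7 _⊛_

_⊕_ : LinForm → LinForm → LinForm
(α , β) ⊕ (α′ , β′) = α + α′ , β + β′

_⊛_ : ℤ → LinForm → LinForm
k ⊛ (α , β) = k * α , k * β

positiveᵇ : LinForm → Bool
positiveᵇ (α , β) = does (0ℤ ℤ.≤? α) ∧ does (0ℤ ℤ.≤? β) ∧ does (0ℤ ℤ.<? α + β)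

-- The game on two vertices v (true) and w (false) with n_{w,v} = p and n_{v,w} = q, played symbolically:
-- (α , β) stands for α a + β b, where a, b > 0 are the initial deficits of v and w, and a state (x , y)
-- records what has been added to c_v and c_w, so that the deficits become a − 2x + q y and b + p x − 2y.
module RankTwoGame (p q : ℕ) where

  State : Set
  State = LinForm × LinForm

  origin : State
  origin = (0ℤ , 0ℤ) , (0ℤ , 0ℤ)

  deficitˢ : Bool → State → LinForm
  deficitˢ true (x , y) = (1ℤ , 0ℤ) ⊕ (- (+ 2) ⊛ x ⊕ + q ⊛ y)
  deficitˢ false (x , y) = (0ℤ , 1ℤ) ⊕ (+ p ⊛ x ⊕ - (+ 2) ⊛ y)

  stepˢ : Bool → State → State
  stepˢ true (x , y) = x ⊕ deficitˢ true (x , y) , y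
  stepˢ false (x , y) = x , y ⊕ deficitˢ false (x , y)

  runˢ : List Bool → State → State
  runˢ [] s = s
  runˢ (t ∷ ts) s = runˢ ts (stepˢ t s)

  positiveRunᵇ : List Bool → State → Bool
  positiveRunᵇ [] s = true
  positiveRunᵇ (t ∷ ts) s = positiveᵇ (deficitˢ t s) ∧ positiveRunᵇ ts (stepˢ t s)

  alternate : ℕ → Bool → List Bool
  alternate ℕ.zero t = []
  alternate (ℕ.suc k) t = t ∷ alternate k (not t)

  Braid : ℕ → Set
  Braid k = T (positiveRunᵇ (alternate k true) origin) × T (positiveRunᵇ (alternate k false) origin)
          × runˢ (alternate k true) origin ≡ runˢ (alternate k false) origin

-- suc h is the Coxeter number 2, 3, 4 or 6 of the rank-two type.
braid : ∀ {p q} → RankTwo p q → ∃ λ h → RankTwoGame.Braid p q (ℕ.suc h)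
braid A₁×A₁ = 1 , _ , _ , refl
braid A₂ = 2 , _ , _ , refl
braid B₂ = 3 , _ , _ , refl
braid B₂ᵀ = 3 , _ , _ , refl
braid G₂ = 5 , _ , _ , refl
braid G₂ᵀ = 5 , _ , _ , refl

-- The modified Kostant game

module KostantGame {r : ℕ} (Γ : Dynkin r) (I : Subset r) where
  open Dynkin Γ
  open Game Γ I
  open DynkinDiagram Γ

  -- The summand of rhs is local to Defs; unification recovers it.
  private
    rhs-summand : Σ (Config → Fin r → Fin r → ℤ) λ t → ∀ c v → rhs c v ≡ Σ[ r ] (t c v) + ind v
    rhs-summand = _ , λ _ _ → refl

    summand≡ : ∀ c v u → proj₁ rhs-summand c v u ≡ adj v u * c u
    summand≡ c v u with u ≟ v
    ... | yes _ = refl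
    ... | no _ = refl

  rhs≡ : ∀ c v → rhs c v ≡ neighbourSum c v + ind v
  rhs≡ c v = trans (proj₂ rhs-summand c v) (cong (_+ ind v) (Σ-cong (summand≡ c v)))

  deficit : Config → Fin r → ℤ
  deficit c v = rhs c v - (+ 2) * c v

  deficit≡ : ∀ c v → deficit c v ≡ neighbourSum c v + ind v - (+ 2) * c v
  deficit≡ c v = cong (_- (+ 2) * c v) (rhs≡ c v)

  sad⇒0<deficit : ∀ {c v} → Sad c v → 0ℤ < deficit c v
  sad⇒0<deficit = i<j⇒0<j-i

  0<deficit⇒sad : ∀ {c v} → 0ℤ < deficit c v → Sad c v
  0<deficit⇒sad = 0<j-i⇒i<j

  sad? : ∀ c v → Dec (Sad c v)
  sad? c v = (+ 2) * c v ℤ.<? rhs c v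

  move≗ : ∀ c v → move c v ≗ c +[ v ] deficit c v
  move≗ c v u with u ≟ v
  ... | yes refl = reflect (c u) (rhs c u)
    where
      reflect : ∀ x h → - x + h ≡ x + (h - (+ 2) * x)
      reflect = solve-∀
  ... | no _ = sym (ℤ.+-identityʳ (c u))

  deficit-+[] : ∀ c w t z → deficit (c +[ w ] t) z ≡ deficit c z + adj z w * t - (+ 2) * point w t z
  deficit-+[] c w t z = begin
      deficit (c +[ w ] t) z
    ≡⟨ deficit≡ (c +[ w ] t) z ⟩
      neighbourSum (c +[ w ] t) z + ind z - (+ 2) * (c z + point w t z)
    ≡⟨ cong (λ s → s + ind z - (+ 2) * (c z + point w t z)) (Σ-*-+[] (adj z) c w t) ⟩
      neighbourSum c z + adj z w * t + ind z - (+ 2) * (c z + point w t z)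
    ≡⟨ regroup (neighbourSum c z) (adj z w * t) (ind z) (c z) (point w t z) ⟩
      neighbourSum c z + ind z - (+ 2) * c z + adj z w * t - (+ 2) * point w t z
    ≡⟨ cong (λ s → s + adj z w * t - (+ 2) * point w t z) (sym (deficit≡ c z)) ⟩
      deficit c z + adj z w * t - (+ 2) * point w t z ∎
    where
      open ≡-Reasoning
      regroup : ∀ R a i x e → R + a + i - (+ 2) * (x + e) ≡ R + i - (+ 2) * x + a - (+ 2) * e
      regroup = solve-∀

  rhs-cong : ∀ {c c′} → c ≗ c′ → ∀ v → rhs c v ≡ rhs c′ v
  rhs-cong {c} {c′} c≗c′ v =
    trans (rhs≡ c v) (trans (cong (λ s → s + ind v) (Σ-cong (λ u → cong (adj v u *_) (c≗c′ u)))) (sym (rhs≡ c′ v)))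

  Sad-cong : ∀ {c c′} → c ≗ c′ → ∀ {v} → Sad c v → Sad c′ v
  Sad-cong c≗c′ {v} = subst₂ _<_ (cong ((+ 2) *_) (c≗c′ v)) (rhs-cong c≗c′ v)

  move-cong : ∀ {c c′} → c ≗ c′ → ∀ v → move c v ≗ move c′ v
  move-cong c≗c′ v u with u ≟ v
  ... | yes _ = cong₂ (λ x h → - x + h) (c≗c′ v) (rhs-cong c≗c′ v)
  ... | no _ = c≗c′ u

  play-cong : ∀ {c c′} → c ≗ c′ → ∀ p → play c p ≗ play c′ p
  play-cong c≗c′ [] = c≗c′
  play-cong c≗c′ (v ∷ p) = play-cong (move-cong c≗c′ v) p

  Valid-cong : ∀ {c c′} → c ≗ c′ → ∀ p → Valid c p → Valid c′ p
  Valid-cong c≗c′ [] _ = tt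
  Valid-cong c≗c′ (v ∷ p) (sad , valid) = Sad-cong c≗c′ sad , Valid-cong (move-cong c≗c′ v) p valid

  Terminal-cong : ∀ {c c′} → c ≗ c′ → Terminal c → Terminal c′
  Terminal-cong c≗c′ terminal v sad = terminal v (Sad-cong (sym ∘ c≗c′) sad)

  play-++ : ∀ c p q → play c (p ++ q) ≡ play (play c p) q
  play-++ c [] q = refl
  play-++ c (v ∷ p) q = play-++ (move c v) p q

  Valid-++ : ∀ {c} p {q} → Valid c p → Valid (play c p) q → Valid c (p ++ q)
  Valid-++ [] _ valid = valid
  Valid-++ (v ∷ p) (sad , valid) valid′ = sad , Valid-++ p valid valid′

  total : Config → ℤ
  total c = Σ[ r ] c

  total-move : ∀ c v → total (move c v) ≡ total c + deficit c v
  total-move c v = trans (Σ-cong (move≗ c v)) (Σ-+[] c v (deficit c v))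

  weightedTotal : Config → ℤ
  weightedTotal c = Σ[ r ] (λ u → (ind u * gram u u) * c u)

  -- With x = Σ c_u α_u this says  c ≥ 0  and  (x , x) = Σ_{u ∈ I} (α_u , α_u) c_u.
  Invariant : Config → Set
  Invariant c = (∀ u → 0ℤ ≤ c u) × QF gram c ≡ weightedTotal c

  Invariant-initial : Invariant initial
  Invariant-initial =
    (λ _ → ℤ.≤-refl) ,
    trans (QF-zero gram (λ _ → refl)) (sym (trans (Σ-cong (λ u → ℤ.*-zeroʳ (ind u * gram u u))) (Σ-zero r)))

  pairing-deficit : ∀ c v → (+ 2) * pairing gram c v ≡ gram v v * (ind v - deficit c v)
  pairing-deficit c v =
    trans (coroot-pairing c v)
          (cong (gram v v *_) (trans (rearrange (c v) (neighbourSum c v) (ind v))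
                                     (cong (_-_ (ind v)) (sym (deficit≡ c v)))))
    where
      rearrange : ∀ x R i → (+ 2) * x - R ≡ i - (R + i - (+ 2) * x)
      rearrange = solve-∀

  Invariant-move : ∀ {c v} → Invariant c → Sad c v → Invariant (move c v)
  Invariant-move {c} {v} (0≤c , Q≡L) sad = 0≤c′ , Q′≡L′
    where
      open ≡-Reasoning
      δ = deficit c v
      0≤c′ : ∀ u → 0ℤ ≤ move c v u
      0≤c′ u = subst (0ℤ ≤_) (sym (move≗ c v u))
                     (ℤ.+-mono-≤ (0≤c u) (point-nonNeg v (ℤ.<⇒≤ (sad⇒0<deficit sad)) u))
      regroup : ∀ d P → (+ 2) * (d * P) ≡ d * ((+ 2) * P)
      regroup = solve-∀
      telescope : ∀ L d g i → L + d * (g * (i - d)) + d * (g * d) ≡ L + (i * g) * d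
      telescope = solve-∀
      Q′≡L′ : QF gram (move c v) ≡ weightedTotal (move c v)
      Q′≡L′ = begin
          QF gram (move c v)
        ≡⟨ QF-cong gram (move≗ c v) ⟩
          QF gram (c +[ v ] δ)
        ≡⟨ QF-+[] gram gram-sym c v δ ⟩
          QF gram c + (+ 2) * (δ * pairing gram c v) + δ * (gram v v * δ)
        ≡⟨ cong₂ (λ s t → s + t + δ * (gram v v * δ)) Q≡L
                 (trans (regroup δ (pairing gram c v)) (cong (δ *_) (pairing-deficit c v))) ⟩
          weightedTotal c + δ * (gram v v * (ind v - δ)) + δ * (gram v v * δ)
        ≡⟨ telescope (weightedTotal c) δ (gram v v) (ind v) ⟩
          weightedTotal c + (ind v * gram v v) * δ
        ≡⟨ sym (Σ-*-+[] (λ u → ind u * gram u u) c v δ) ⟩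
          weightedTotal (c +[ v ] δ)
        ≡⟨ Σ-cong (λ u → cong ((ind u * gram u u) *_) (sym (move≗ c v u))) ⟩
          weightedTotal (move c v) ∎

  Invariant-play : ∀ {c} p → Invariant c → Valid c p → Invariant (play c p)
  Invariant-play [] inv _ = inv
  Invariant-play (v ∷ p) inv (sad , valid) = Invariant-play p (Invariant-move inv sad) valid

  private
    gramBound = sumBound r gram gram-sym gram-pos
    weightBound = upper-bound (λ u → ind u * gram u u)

  N : ℤ
  N = proj₁ gramBound * + proj₁ weightBound

  total-bound : ∀ {c} → Invariant c → total c ≤ N
  total-bound {c} (0≤c , Q≡L) = square-≤-cancel (Σ-nonNeg 0≤c) (*-nonNeg 0≤K (+≤+ ℕ.z≤n)) (begin
      total c * total c          ≤⟨ bound c 0≤c ⟩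
      K * QF gram c              ≡⟨ cong (K *_) Q≡L ⟩
      K * weightedTotal c        ≤⟨ *-monoˡ-≤-nonNeg′ 0≤K L≤Gt ⟩
      K * (+ G * total c)        ≡⟨ sym (ℤ.*-assoc K (+ G) (total c)) ⟩
      N * total c                ∎)
    where
      open ℤ.≤-Reasoning
      K = proj₁ gramBound
      0≤K = proj₁ (proj₂ gramBound)
      bound = proj₂ (proj₂ gramBound)
      G = proj₁ weightBound
      L≤Gt : weightedTotal c ≤ + G * total c
      L≤Gt = ℤ.≤-trans (Σ-mono-≤ (λ u → ℤ.*-monoʳ-≤-nonNeg (c u) {{nonNegative (0≤c u)}} (proj₂ weightBound u)))
                       (ℤ.≤-reflexive (*-distribˡ-Σ (+ G) c))

  Budget : ℕ → Config → Set
  Budget k c = N ≤ + k + total c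

  budget : ∀ c → Budget ∣ N - total c ∣ c
  budget c = subst (_≤ + ∣ N - total c ∣ + total c) (sub-add N (total c)) (ℤ.+-monoˡ-≤ (total c) (i≤+∣i∣ (N - total c)))
    where
      sub-add : ∀ n t → n - t + t ≡ n
      sub-add = solve-∀

  budget-move : ∀ {k c v} → Budget (ℕ.suc k) c → Sad c v → Budget k (move c v)
  budget-move {k} {c} {v} bud sad = begin
      N                                ≤⟨ bud ⟩
      + ℕ.suc k + total c              ≡⟨ cong (_+ total c) (ℤ.pos-+ 1 k) ⟩
      1ℤ + + k + total c               ≡⟨ shift (+ k) (total c) ⟩
      + k + (total c + 1ℤ)             ≤⟨ ℤ.+-monoʳ-≤ (+ k) (ℤ.+-monoʳ-≤ (total c) (ℤ.i<j⇒suc[i]≤j (sad⇒0<deficit sad))) ⟩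
      + k + (total c + deficit c v)    ≡⟨ cong (_+_ (+ k)) (sym (total-move c v)) ⟩
      + k + total (move c v)           ∎
    where
      open ℤ.≤-Reasoning
      shift : ∀ k t → 1ℤ + k + t ≡ k + (t + 1ℤ)
      shift = solve-∀

  budget-zero : ∀ {c v} → Invariant c → Budget 0 c → ¬ Sad c v
  budget-zero {c} {v} inv bud sad = ℤ.<-irrefl refl (begin-strict
      N                              ≤⟨ bud ⟩
      0ℤ + total c                   ≡⟨ ℤ.+-identityˡ (total c) ⟩
      total c                        ≡⟨ sym (ℤ.+-identityʳ (total c)) ⟩
      total c + 0ℤ                   <⟨ ℤ.+-monoʳ-< (total c) (sad⇒0<deficit sad) ⟩
      total c + deficit c v          ≡⟨ sym (total-move c v) ⟩
      total (move c v)               ≤⟨ total-bound (Invariant-move inv sad) ⟩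
      N                              ∎)
    where open ℤ.≤-Reasoning

  no-infinite-run : ∀ k (cs : ℕ → Config) (f : ℕ → Fin r) → Invariant (cs 0) → Budget k (cs 0) →
    (∀ i → cs (ℕ.suc i) ≡ move (cs i) (f i)) → ¬ (∀ i → Sad (cs i) (f i))
  no-infinite-run ℕ.zero cs f inv bud next sad = budget-zero inv bud (sad 0)
  no-infinite-run (ℕ.suc k) cs f inv bud next sad =
    no-infinite-run k (cs ∘ ℕ.suc) (f ∘ ℕ.suc)
      (subst Invariant (sym (next 0)) (Invariant-move inv (sad 0)))
      (subst (Budget k) (sym (next 0)) (budget-move bud (sad 0)))
      (next ∘ ℕ.suc) (sad ∘ ℕ.suc)

  -- Abstracting play turns the prefix function local to InfinitePlay into a unification solution.
  private
    infinite-play-prefixes : Σ ((ℕ → Fin r) → ℕ → List (Fin r)) λ prefix →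
      InfinitePlay initial ≡ (∃ λ f → ∀ k → Sad (play initial (prefix f k)) (f k))
    infinite-play-prefixes with play
    ... | _ = _ , refl

  no-infinite-play : ¬ InfinitePlay initial
  no-infinite-play (f , sad) =
    no-infinite-run _ (λ k → play initial (prefix f k)) f Invariant-initial (budget initial)
      (λ k → play-++ initial (prefix f k) (f k ∷ [])) sad
    where
      prefix = proj₁ infinite-play-prefixes

  Completion : Config → Set
  Completion c = ∃ λ q → Valid c q × Terminal (play c q)

  complete-within : ∀ k {c} → Invariant c → Budget k c → Completion c
  complete-within k {c} inv bud with any? (sad? c)
  ... | no none = [] , tt , λ v sad → none (v , sad)
  complete-within ℕ.zero inv bud | yes (v , sad) = ⊥-elim (budget-zero inv bud sad)
  complete-within (ℕ.suc k) inv bud | yes (v , sad)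
    with complete-within k (Invariant-move inv sad) (budget-move bud sad)
  ... | q , valid , terminal = v ∷ q , (sad , valid) , terminal

  complete : ∀ {c} → Invariant c → Completion c
  complete {c} inv = complete-within _ inv (budget c)

  module Realisation (c : Config) {v w : Fin r} (v≢w : v ≢ w) where
    open RankTwoGame (n w v) (n v w)

    ev : LinForm → ℤ
    ev (α , β) = α * deficit c v + β * deficit c w

    ev-affine : ∀ e k x l y → ev (e ⊕ (k ⊛ x ⊕ l ⊛ y)) ≡ ev e + (k * ev x + l * ev y)
    ev-affine (ε , ε′) k (α , β) l (α′ , β′) = expand ε ε′ k α β l α′ β′ (deficit c v) (deficit c w)
      where
        expand : ∀ ε ε′ k α β l α′ β′ a b →
          (ε + (k * α + l * α′)) * a + (ε′ + (k * β + l * β′)) * b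
            ≡ (ε * a + ε′ * b) + (k * (α * a + β * b) + l * (α′ * a + β′ * b))
        expand = solve-∀

    ev-⊕ : ∀ f g → ev (f ⊕ g) ≡ ev f + ev g
    ev-⊕ (α , β) (α′ , β′) = expand α β α′ β′ (deficit c v) (deficit c w)
      where
        expand : ∀ α β α′ β′ a b → (α + α′) * a + (β + β′) * b ≡ (α * a + β * b) + (α′ * a + β′ * b)
        expand = solve-∀

    vertex : Bool → Fin r
    vertex true = v
    vertex false = w

    realise : State → Config
    realise (x , y) = c +[ v ] ev x +[ w ] ev y

    realise-origin : c ≗ realise origin
    realise-origin u =
      sym (trans (cong₂ (λ s t → c u + s + t) (point-zero v u) (point-zero w u))
                 (trans (ℤ.+-identityʳ _) (ℤ.+-identityʳ (c u))))

    deficit-realise : ∀ t s → deficit (realise s) (vertex t) ≡ ev (deficitˢ t s)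
    deficit-realise true (x , y) = begin
        deficit (c +[ v ] ev x +[ w ] ev y) v
      ≡⟨ deficit-+[] (c +[ v ] ev x) w (ev y) v ⟩
        deficit (c +[ v ] ev x) v + adj v w * ev y - (+ 2) * point w (ev y) v
      ≡⟨ cong₂ (λ s t → s + t * ev y - (+ 2) * point w (ev y) v) (deficit-+[] c v (ev x) v) (adj-off (v≢w ∘ sym)) ⟩
        deficit c v + adj v v * ev x - (+ 2) * point v (ev x) v + + n v w * ev y - (+ 2) * point w (ev y) v
      ≡⟨ cong₃ (adj-diag v) (point-at v (ev x)) (point-off (ev y) v≢w) ⟩
        deficit c v + 0ℤ * ev x - (+ 2) * ev x + + n v w * ev y - (+ 2) * 0ℤ
      ≡⟨ simplify (deficit c v) (deficit c w) (ev x) (+ n v w) (ev y) ⟩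
        (1ℤ * deficit c v + 0ℤ * deficit c w) + (- (+ 2) * ev x + + n v w * ev y)
      ≡⟨ sym (ev-affine (1ℤ , 0ℤ) (- (+ 2)) x (+ n v w) y) ⟩
        ev (deficitˢ true (x , y)) ∎
      where
        open ≡-Reasoning
        cong₃ : ∀ {d e o} → adj v v ≡ d → point v (ev x) v ≡ e → point w (ev y) v ≡ o →
          deficit c v + adj v v * ev x - (+ 2) * point v (ev x) v + + n v w * ev y - (+ 2) * point w (ev y) v
            ≡ deficit c v + d * ev x - (+ 2) * e + + n v w * ev y - (+ 2) * o
        cong₃ refl refl refl = refl
        simplify : ∀ a b X q Y → a + 0ℤ * X - (+ 2) * X + q * Y - (+ 2) * 0ℤ ≡ (1ℤ * a + 0ℤ * b) + (- (+ 2) * X + q * Y)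
        simplify = solve-∀
    deficit-realise false (x , y) = begin
        deficit (c +[ v ] ev x +[ w ] ev y) w
      ≡⟨ deficit-+[] (c +[ v ] ev x) w (ev y) w ⟩
        deficit (c +[ v ] ev x) w + adj w w * ev y - (+ 2) * point w (ev y) w
      ≡⟨ cong (λ s → s + adj w w * ev y - (+ 2) * point w (ev y) w) (deficit-+[] c v (ev x) w) ⟩
        deficit c w + adj w v * ev x - (+ 2) * point v (ev x) w + adj w w * ev y - (+ 2) * point w (ev y) w
      ≡⟨ cong₄ (adj-off v≢w) (point-off (ev x) (v≢w ∘ sym)) (adj-diag w) (point-at w (ev y)) ⟩
        deficit c w + + n w v * ev x - (+ 2) * 0ℤ + 0ℤ * ev y - (+ 2) * ev y
      ≡⟨ simplify (deficit c v) (deficit c w) (+ n w v) (ev x) (ev y) ⟩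
        (0ℤ * deficit c v + 1ℤ * deficit c w) + (+ n w v * ev x + - (+ 2) * ev y)
      ≡⟨ sym (ev-affine (0ℤ , 1ℤ) (+ n w v) x (- (+ 2)) y) ⟩
        ev (deficitˢ false (x , y)) ∎
      where
        open ≡-Reasoning
        cong₄ : ∀ {p e d o} → adj w v ≡ p → point v (ev x) w ≡ e → adj w w ≡ d → point w (ev y) w ≡ o →
          deficit c w + adj w v * ev x - (+ 2) * point v (ev x) w + adj w w * ev y - (+ 2) * point w (ev y) w
            ≡ deficit c w + p * ev x - (+ 2) * e + d * ev y - (+ 2) * o
        cong₄ refl refl refl refl = refl
        simplify : ∀ a b p X Y → b + p * X - (+ 2) * 0ℤ + 0ℤ * Y - (+ 2) * Y ≡ (0ℤ * a + 1ℤ * b) + (p * X + - (+ 2) * Y)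
        simplify = solve-∀

    move-realise : ∀ t s → move (realise s) (vertex t) ≗ realise (stepˢ t s)
    move-realise true (x , y) u = begin
        move (realise (x , y)) v u
      ≡⟨ move≗ (realise (x , y)) v u ⟩
        c u + point v (ev x) u + point w (ev y) u + point v D u
      ≡⟨ swap (c u) (point v (ev x) u) (point w (ev y) u) (point v D u) ⟩
        c u + (point v (ev x) u + point v D u) + point w (ev y) u
      ≡⟨ cong (λ t → c u + t + point w (ev y) u) (point-+ v (ev x) D u) ⟩
        c u + point v (ev x + D) u + point w (ev y) u
      ≡⟨ cong (λ t → c u + point v t u + point w (ev y) u)
              (trans (cong (_+_ (ev x)) (deficit-realise true (x , y))) (sym (ev-⊕ x (deficitˢ true (x , y))))) ⟩
        realise (stepˢ true (x , y)) u ∎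
      where
        open ≡-Reasoning
        D = deficit (realise (x , y)) v
        swap : ∀ a b c d → a + b + c + d ≡ a + (b + d) + c
        swap = solve-∀
    move-realise false (x , y) u = begin
        move (realise (x , y)) w u
      ≡⟨ move≗ (realise (x , y)) w u ⟩
        c u + point v (ev x) u + point w (ev y) u + point w D u
      ≡⟨ ℤ.+-assoc (c u + point v (ev x) u) (point w (ev y) u) (point w D u) ⟩
        c u + point v (ev x) u + (point w (ev y) u + point w D u)
      ≡⟨ cong (_+_ (c u + point v (ev x) u)) (point-+ w (ev y) D u) ⟩
        c u + point v (ev x) u + point w (ev y + D) u
      ≡⟨ cong (λ t → c u + point v (ev x) u + point w t u)
              (trans (cong (_+_ (ev y)) (deficit-realise false (x , y))) (sym (ev-⊕ y (deficitˢ false (x , y))))) ⟩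
        realise (stepˢ false (x , y)) u ∎
      where
        open ≡-Reasoning
        D = deficit (realise (x , y)) w

    module _ (0<a : 0ℤ < deficit c v) (0<b : 0ℤ < deficit c w) where

      positiveᵇ-sound : ∀ f → T (positiveᵇ f) → 0ℤ < ev f
      positiveᵇ-sound (α , β) ok with 0ℤ ℤ.≤? α | 0ℤ ℤ.≤? β | 0ℤ ℤ.<? α + β
      ... | yes 0≤α | yes 0≤β | yes 0<α+β = ℤ.<-≤-trans 0<α+β (ℤ.+-mono-≤ (≤scaled 0≤α 0<a) (≤scaled 0≤β 0<b))
        where
          ≤scaled : ∀ {γ d} → 0ℤ ≤ γ → 0ℤ < d → γ ≤ γ * d
          ≤scaled {γ} 0≤γ 0<d = subst (_≤ γ * _) (ℤ.*-identityʳ γ) (*-monoˡ-≤-nonNeg′ 0≤γ (ℤ.i<j⇒suc[i]≤j 0<d))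

      run-realise : ∀ ts s → T (positiveRunᵇ ts s) →
        Valid (realise s) (map vertex ts) × play (realise s) (map vertex ts) ≗ realise (runˢ ts s)
      run-realise [] s _ = tt , λ _ → refl
      run-realise (t ∷ ts) s ok with Equivalence.to T-∧ ok
      ... | ok-t , ok-ts with run-realise ts (stepˢ t s) ok-ts
      ... | valid , played =
        (0<deficit⇒sad (subst (0ℤ <_) (sym (deficit-realise t s)) (positiveᵇ-sound (deficitˢ t s) ok-t)) ,
         Valid-cong (sym ∘ move-realise t s) (map vertex ts) valid) ,
        λ u → trans (play-cong (move-realise t s) (map vertex ts) u) (played u)

  Joinable : Config → Config → Set
  Joinable c c′ = ∃ λ s → ∃ λ t → Valid c s × Valid c′ t × play c s ≗ play c′ t

  local-confluence : ∀ {c v w} → v ≢ w → Sad c v → Sad c w → Joinable (move c v) (move c w)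
  local-confluence {c} {v} {w} v≢w sadᵛ sadʷ with braid (rankTwo v≢w)
  ... | h , ok-v , ok-w , same =
    sᵛ , sʷ , Valid-cong (from-origin v) sᵛ (proj₂ (proj₁ run-v)) ,
    Valid-cong (from-origin w) sʷ (proj₂ (proj₁ run-w)) , joined
    where
      open Realisation c v≢w
      open RankTwoGame (n w v) (n v w)
      sᵛ = map vertex (alternate h false)
      sʷ = map vertex (alternate h true)
      run-v = run-realise (sad⇒0<deficit sadᵛ) (sad⇒0<deficit sadʷ) (alternate (ℕ.suc h) true) origin ok-v
      run-w = run-realise (sad⇒0<deficit sadᵛ) (sad⇒0<deficit sadʷ) (alternate (ℕ.suc h) false) origin ok-w
      from-origin : ∀ u → move (realise origin) u ≗ move c u
      from-origin = move-cong (sym ∘ realise-origin)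
      joined : play (move c v) sᵛ ≗ play (move c w) sʷ
      joined u = begin
          play (move c v) sᵛ u                                ≡⟨ play-cong (move-cong realise-origin v) sᵛ u ⟩
          play (move (realise origin) v) sᵛ u                 ≡⟨ proj₂ run-v u ⟩
          realise (runˢ (alternate (ℕ.suc h) true) origin) u  ≡⟨ cong (λ s → realise s u) same ⟩
          realise (runˢ (alternate (ℕ.suc h) false) origin) u ≡⟨ sym (proj₂ run-w u) ⟩
          play (move (realise origin) w) sʷ u                 ≡⟨ play-cong (from-origin w) sʷ u ⟩
          play (move c w) sʷ u                                ∎
        where open ≡-Reasoning

  terminal-unique-within : ∀ k {c} → Invariant c → Budget k c → ∀ {p₁ p₂} → Valid c p₁ → Valid c p₂ →
    Terminal (play c p₁) → Terminal (play c p₂) → play c p₁ ≗ play c p₂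
  terminal-unique-within _ _ _ {[]} {[]} _ _ _ _ = λ _ → refl
  terminal-unique-within _ _ _ {[]} {w ∷ _} _ (sadʷ , _) terminal₁ _ = ⊥-elim (terminal₁ w sadʷ)
  terminal-unique-within _ _ _ {v ∷ _} {[]} (sadᵛ , _) _ _ terminal₂ = ⊥-elim (terminal₂ v sadᵛ)
  terminal-unique-within ℕ.zero inv bud {v ∷ _} {_ ∷ _} (sadᵛ , _) _ _ _ = ⊥-elim (budget-zero inv bud sadᵛ)
  terminal-unique-within (ℕ.suc k) {c} inv bud {v ∷ p₁} {w ∷ p₂} (sadᵛ , valid₁) (sadʷ , valid₂) terminal₁ terminal₂
    with v ≟ w
  ... | yes refl = terminal-unique-within k (Invariant-move inv sadᵛ) (budget-move bud sadᵛ) valid₁ valid₂ terminal₁ terminal₂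
  ... | no v≢w = join (local-confluence v≢w sadᵛ sadʷ)
    where
      unique-after : ∀ {u} → Sad c u → ∀ {p p′} → Valid (move c u) p → Valid (move c u) p′ →
        Terminal (play (move c u) p) → Terminal (play (move c u) p′) → play (move c u) p ≗ play (move c u) p′
      unique-after sad = terminal-unique-within k (Invariant-move inv sad) (budget-move bud sad)
      join : Joinable (move c v) (move c w) → play (move c v) p₁ ≗ play (move c w) p₂
      join (s , t , valid-s , valid-t , s≗t) with complete (Invariant-play s (Invariant-move inv sadᵛ) valid-s)
      ... | q , valid-q , terminal-q = λ u → trans (left u) (trans (middle u) (sym (right u)))
        where
          played-s : play (move c v) (s ++ q) ≡ play (play (move c v) s) q
          played-s = play-++ (move c v) s q
          played-t : play (move c w) (t ++ q) ≡ play (play (move c w) t) q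
          played-t = play-++ (move c w) t q
          left : play (move c v) p₁ ≗ play (move c v) (s ++ q)
          left = unique-after sadᵛ valid₁ (Valid-++ s valid-s valid-q) terminal₁ (subst Terminal (sym played-s) terminal-q)
          middle : play (move c v) (s ++ q) ≗ play (move c w) (t ++ q)
          middle u = trans (cong-app played-s u) (trans (play-cong s≗t q u) (sym (cong-app played-t u)))
          right : play (move c w) p₂ ≗ play (move c w) (t ++ q)
          right = unique-after sadʷ valid₂ (Valid-++ t valid-t (Valid-cong s≗t q valid-q)) terminal₂
                    (subst Terminal (sym played-t) (Terminal-cong (play-cong s≗t q) terminal-q))

  terminal-unique : ∀ {c} → Invariant c → ∀ {p₁ p₂} → Valid c p₁ → Valid c p₂ →
    Terminal (play c p₁) → Terminal (play c p₂) → play c p₁ ≗ play c p₂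
  terminal-unique {c} inv = terminal-unique-within _ inv (budget c)

mainTheorem5 : ∀ {r : ℕ} (Γ : Dynkin r) (I : Subset r) →
    let open Game Γ I in
    (¬ InfinitePlay initial)
    × (∀ (p : List _) → Valid initial p →
         ∃ λ q → Valid initial (p ++ q) × Terminal (play initial (p ++ q)))
    × (Σ Config λ cI → ∀ (p : List _) → Valid initial p →
         Terminal (play initial p) → ∀ v → play initial p v ≡ cI v)
mainTheorem5 Γ I = no-infinite-play , extend , play initial q₀ , unique
  where
    open Game Γ I
    open KostantGame Γ I
    completion₀ = complete Invariant-initial
    q₀ = proj₁ completion₀
    extend : ∀ p → Valid initial p → ∃ λ q → Valid initial (p ++ q) × Terminal (play initial (p ++ q))
    extend p valid with complete (Invariant-play p Invariant-initial valid)
    ... | q , valid′ , terminal = q , Valid-++ p valid valid′ , subst Terminal (sym (play-++ initial p q)) terminal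
    unique : ∀ p → Valid initial p → Terminal (play initial p) → play initial p ≗ play initial q₀
    unique p valid terminal =
      terminal-unique Invariant-initial valid (proj₁ (proj₂ completion₀)) terminal (proj₂ (proj₂ completion₀))
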